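{- For $n\in\mathbb{N}$ let $\mathrm{Out}_n : NC^{\mathrm{(mton)}}(n)\to\mathbb{N}$ be $\mathrm{Out}_n(\pi,u) := |\{V\in\pi : V \text{ is outer}\}|$, with $NC^{\mathrm{(mton)}}(n)$ carrying the uniform distribution. Then $E[\mathrm{Out}_n] = \frac{2n+1}{3}$ for every $n\in\mathbb{N}$.
   Context: $NC(n)$: non-crossing partitions of $\{1,\ldots,n\}$. For blocks $V,W$, "$V$ nested inside $W$" means $\min V>\min W$ and $\max V<\max W$. A block $V\in\pi$ is outer if there is no $W\in\pi$ with $V$ nested inside $W$. A monotonic ordering of $\pi\in NC(n)$ is a bijection $u:\pi\to\{1,\ldots,|\pi|\}$ with $u(V)>u(W)$ whenever $V$ is nested inside $W$; $NC^{\mathrm{(mton)}}(n)$ is the set of pairs $(\pi,u)$ with $\pi\in NC(n)$ and $u$ a monotonic ordering of $\pi$. -}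

module Defs where

open import Data.Nat using (ℕ)
open import Data.Fin using (Fin; _<_; _<?_)
open import Data.Fin.Properties using (_≟_; any?; all?)
open import Data.Vec using (Vec; lookup)
open import Data.List using (List; length; filter; allFin)
open import Data.Product using (Σ; ∃; _×_; _,_)
open import Relation.Nullary using (¬_; Dec)
open import Relation.Nullary.Decidable using (_×-dec_; _→-dec_; ¬?)
open import Relation.Binary.PropositionalEquality using (_≡_; _≢_)

-- A pair (π , u) with π a set partition of {1..n} (here Fin n = {0..n-1}) and
-- u : π → {1..|π|} a bijection is encoded by the labelling i ↦ u(block of i),
-- written as a vector v of length n with entries in Fin k (label j ↔ value j+1).
-- The blocks of π are the fibres of v; u is a bijection iff v is surjective onto Fin k.
Code : ℕ → Set
Code n = Σ ℕ (λ k → Vec (Fin k) n)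

module _ {n k : ℕ} (v : Vec (Fin k) n) where

  InBlock : Fin n → Fin k → Set
  InBlock i a = lookup v i ≡ a

  Surjective : Set
  Surjective = (a : Fin k) → ∃ λ i → InBlock i a

  NonCrossing : Set
  NonCrossing = ∀ (i j l m : Fin n) → i < j → j < l → l < m →
    InBlock i (lookup v l) → InBlock j (lookup v m) → lookup v i ≡ lookup v j

  -- block a nested inside block b:  min a > min b  and  max a < max b
  -- (min a > min b  ⇔  some element of b lies below every element of a, etc.)
  Nested : Fin k → Fin k → Set
  Nested a b =
    (∃ λ w → InBlock w b × (∀ x → InBlock x a → w < x)) ×
    (∃ λ w → InBlock w b × (∀ x → InBlock x a → x < w))

  nested? : (a b : Fin k) → Dec (Nested a b)
  nested? a b =
    any? (λ w → (lookup v w ≟ b) ×-dec all? (λ x → (lookup v x ≟ a) →-dec (w <? x)))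
    ×-dec
    any? (λ w → (lookup v w ≟ b) ×-dec all? (λ x → (lookup v x ≟ a) →-dec (x <? w)))

  Monotonic : Set
  Monotonic = ∀ a b → Nested a b → b < a

  Outer : Fin k → Set
  Outer a = ¬ (∃ λ b → Nested a b)

  outer? : (a : Fin k) → Dec (Outer a)
  outer? a = ¬? (any? (λ b → nested? a b))

  outCount : ℕ
  outCount = length (filter outer? (allFin k))

IsNCmton : {n : ℕ} → Code n → Set
IsNCmton (k , v) = Surjective v × NonCrossing v × Monotonic v

Out : {n : ℕ} → Code n → ℕ
Out (k , v) = outCount v

-- Every monotonically ordered non-crossing partition of m + 1 points arises from exactly one on
-- m points. If the block with the largest label is a singleton {p}, deleting it gives the parent;
-- otherwise the first element of that top block is immediately followed by another of its elements
-- (anything in between would be nested inside the top block and so need a larger label), and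
-- deleting that second element gives the parent. Conversely a partition on m ≥ 1 points has m + 2
-- children: a new top singleton at each of the m + 1 positions, and the duplicate of the first
-- element of its top block. Duplicating keeps the outer blocks; inserting {p} adds an outer block
-- exactly when no block straddles the gap before p, and a partition with o outer blocks leaves
-- exactly o + 1 of its m + 1 gaps unstraddled. So the children carry (m + 3) o + 1 outer blocks in
-- total, whence A(m + 1) = (m + 2) A(m) and S(m + 1) = (m + 3) S(m) + A(m) for the number A and the
-- total outer-block count S, and 3 S(m) = (2m + 1) A(m) follows by induction.

module Submission where

open import Defs
open import Level using (0ℓ)
open import Function using (_∘_)
open import Function.Bundles using (_⇔_; mk⇔; Equivalence)
open import Data.Empty using (⊥; ⊥-elim)
open import Data.Sum using (inj₁; inj₂)
open import Data.Product using (Σ; ∃; ∃₂; _×_; _,_; proj₁; proj₂)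
open import Relation.Nullary using (¬_; Dec; yes; no)
open import Relation.Nullary.Decidable using (map′; _×-dec_; ¬?)
open import Relation.Unary using (Pred; Decidable)
open import Relation.Binary.Definitions using (tri<; tri≈; tri>)
open import Relation.Binary.PropositionalEquality
open import Data.Nat using (ℕ; zero; suc; _+_; _*_; _≤_; _<_; z≤n; s≤s; _≤?_; _<?_)
open import Data.Nat.Properties
open import Data.Nat.Tactic.RingSolver using (solve-∀)
open import Data.Nat.ListAction using (sum)
open import Data.Nat.ListAction.Properties using (sum-++; sum-↭)
open import Algebra.Properties.CommutativeMonoid.Sum +-0-commutativeMonoid
  using (sum-syntax; sum-remove; sum-init-last; sum-cong-≗; ∑-distrib-+)
open import Data.Fin using (Fin; zero; suc; toℕ; fromℕ; inject₁; punchIn; punchOut; pinch; lower₁)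
import Data.Fin.Properties as Fin
open import Data.Fin.Properties using (any?)
open import Data.Vec using (Vec; []; _∷_; lookup)
import Data.Vec as Vec
import Data.Vec.Properties as Vec
open import Data.List using (List; []; _∷_; _++_; length; map; filter; concatMap)
import Data.List as List
open import Data.List.Properties using (length-++; length-tabulate; map-++)
open import Data.List.Relation.Unary.All using (All; []; _∷_)
import Data.List.Relation.Unary.All as All
open import Data.List.Relation.Unary.AllPairs using ([]; _∷_)
open import Data.List.Relation.Unary.Any using (here)
open import Data.List.Relation.Unary.Unique.Propositional using (Unique)
import Data.List.Relation.Unary.Unique.Propositional.Properties as Unique
open import Data.List.Membership.Propositional using (_∈_; find; lose)
open import Data.List.Membership.Propositional.Properties
  using (∈-++⁺ˡ; ∈-++⁺ʳ; ∈-++⁻; ∈-tabulate⁺; ∈-tabulate⁻; ∈-concatMap⁺; ∈-concatMap⁻)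
open import Data.List.Membership.Propositional.Properties.WithK using (unique∧set⇒bag)
open import Data.List.Relation.Binary.BagAndSetEquality using (∼bag⇒↭)
open import Data.List.Relation.Binary.Permutation.Propositional using (_↭_)
open import Data.List.Relation.Binary.Permutation.Propositional.Properties using (↭-length)
  renaming (map⁺ to ↭-map⁺)

private variable m k : ℕ

toℕ-punchIn-< : (p : Fin (suc m)) (e : Fin m) → toℕ e < toℕ p → toℕ (punchIn p e) ≡ toℕ e
toℕ-punchIn-< (suc p) zero    _         = refl
toℕ-punchIn-< (suc p) (suc e) (s≤s e<p) = cong suc (toℕ-punchIn-< p e e<p)

toℕ-punchIn-≥ : (p : Fin (suc m)) (e : Fin m) → toℕ p ≤ toℕ e → toℕ (punchIn p e) ≡ suc (toℕ e)
toℕ-punchIn-≥ zero    e       _         = refl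
toℕ-punchIn-≥ (suc p) (suc e) (s≤s p≤e) = cong suc (toℕ-punchIn-≥ p e p≤e)

toℕ≤toℕ-punchIn : (p : Fin (suc m)) (e : Fin m) → toℕ e ≤ toℕ (punchIn p e)
toℕ≤toℕ-punchIn zero    e       = n≤1+n _
toℕ≤toℕ-punchIn (suc p) zero    = z≤n
toℕ≤toℕ-punchIn (suc p) (suc e) = s≤s (toℕ≤toℕ-punchIn p e)

toℕ-punchIn≤suc : (p : Fin (suc m)) (e : Fin m) → toℕ (punchIn p e) ≤ suc (toℕ e)
toℕ-punchIn≤suc zero    e       = ≤-refl
toℕ-punchIn≤suc (suc p) zero    = z≤n
toℕ-punchIn≤suc (suc p) (suc e) = s≤s (toℕ-punchIn≤suc p e)

punchIn-mono-< : (p : Fin (suc m)) (e e′ : Fin m) → toℕ e < toℕ e′ → toℕ (punchIn p e) < toℕ (punchIn p e′)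
punchIn-mono-< p e e′ e<e′ =
  Fin.≤∧≢⇒< (Fin.punchIn-mono-≤ p e e′ (<⇒≤ e<e′)) (Fin.<⇒≢ e<e′ ∘ Fin.punchIn-injective p e e′)

punchIn-cancel-< : (p : Fin (suc m)) (e e′ : Fin m) → toℕ (punchIn p e) < toℕ (punchIn p e′) → toℕ e < toℕ e′
punchIn-cancel-< p e e′ lt =
  Fin.≤∧≢⇒< (Fin.punchIn-cancel-≤ p e e′ (<⇒≤ lt)) (Fin.<⇒≢ lt ∘ cong (punchIn p))

toℕ-pinch-≤ : (i : Fin m) (j : Fin (suc m)) → toℕ j ≤ toℕ i → toℕ (pinch i j) ≡ toℕ j
toℕ-pinch-≤ zero    zero    _         = refl
toℕ-pinch-≤ (suc i) zero    _         = refl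
toℕ-pinch-≤ (suc i) (suc j) (s≤s j≤i) = cong suc (toℕ-pinch-≤ i j j≤i)

suc-toℕ-pinch-> : (i : Fin m) (j : Fin (suc m)) → toℕ i < toℕ j → suc (toℕ (pinch i j)) ≡ toℕ j
suc-toℕ-pinch-> zero    (suc j) _         = refl
suc-toℕ-pinch-> (suc i) (suc j) (s≤s i<j) = cong suc (suc-toℕ-pinch-> i j i<j)

<pinch⇒punchIn-suc< : (i e : Fin m) (x : Fin (suc m)) → toℕ e < toℕ (pinch i x) → toℕ (punchIn (suc i) e) < toℕ x
<pinch⇒punchIn-suc< zero    zero    (suc x) _         = s≤s z≤n
<pinch⇒punchIn-suc< zero    (suc e) (suc x) e<x       = s≤s e<x
<pinch⇒punchIn-suc< (suc i) zero    (suc x) _         = s≤s z≤n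
<pinch⇒punchIn-suc< (suc i) (suc e) (suc x) (s≤s e<x) = s≤s (<pinch⇒punchIn-suc< i e x e<x)

pinch<⇒<punchIn-suc : (i e : Fin m) (x : Fin (suc m)) → toℕ (pinch i x) < toℕ e → toℕ x < toℕ (punchIn (suc i) e)
pinch<⇒<punchIn-suc zero    (suc e) zero    _         = s≤s z≤n
pinch<⇒<punchIn-suc (suc i) (suc e) zero    _         = s≤s z≤n
pinch<⇒<punchIn-suc zero    (suc e) (suc x) x<e       = s≤s x<e
pinch<⇒<punchIn-suc (suc i) (suc e) (suc x) (s≤s x<e) = s≤s (pinch<⇒<punchIn-suc i e x x<e)

pinch-punchIn-suc : (i e : Fin m) → pinch i (punchIn (suc i) e) ≡ e
pinch-punchIn-suc zero    zero    = refl
pinch-punchIn-suc zero    (suc e) = refl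
pinch-punchIn-suc (suc i) zero    = refl
pinch-punchIn-suc (suc i) (suc e) = cong suc (pinch-punchIn-suc i e)

punchIn-suc-pinch : (i : Fin m) (j : Fin (suc m)) → j ≢ suc i → punchIn (suc i) (pinch i j) ≡ j
punchIn-suc-pinch zero    zero          _   = refl
punchIn-suc-pinch zero    (suc zero)    j≢1 = ⊥-elim (j≢1 refl)
punchIn-suc-pinch zero    (suc (suc j)) _   = refl
punchIn-suc-pinch (suc i) zero          _   = refl
punchIn-suc-pinch (suc i) (suc j)       j≢i = cong suc (punchIn-suc-pinch i j (j≢i ∘ cong suc))

pinch-suc-self : (i : Fin m) → pinch i (suc i) ≡ i
pinch-suc-self zero    = refl
pinch-suc-self (suc i) = cong suc (pinch-suc-self i)

pinch-inject₁-self : (i : Fin m) → pinch i (inject₁ i) ≡ i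
pinch-inject₁-self zero    = refl
pinch-inject₁-self (suc i) = cong suc (pinch-inject₁-self i)

punchIn-suc-self : (i : Fin m) → punchIn (suc i) i ≡ inject₁ i
punchIn-suc-self zero    = refl
punchIn-suc-self (suc i) = cong suc (punchIn-suc-self i)

data PunchInView (p : Fin (suc m)) : Fin (suc m) → Set where
  pivot   : PunchInView p p
  punched : (e : Fin m) → PunchInView p (punchIn p e)

punchInView : (p j : Fin (suc m)) → PunchInView p j
punchInView p j with p Fin.≟ j
... | yes refl = pivot
... | no p≢j   = subst (PunchInView p) (Fin.punchIn-punchOut p≢j) (punched (punchOut p≢j))

data LabelView : Fin (suc k) → Set where
  top : LabelView (fromℕ k)
  old : (a : Fin k) → LabelView (inject₁ a)

labelView : (a : Fin (suc k)) → LabelView a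
labelView {zero}  zero    = top
labelView {suc k} zero    = old zero
labelView {suc k} (suc a) with labelView a
... | top   = top
... | old b = old (suc b)

𝟙 : {P : Set} → Dec P → ℕ
𝟙 (yes _) = 1
𝟙 (no _)  = 0

𝟙-cong : {P Q : Set} → (P → Q) → (Q → P) → (P? : Dec P) (Q? : Dec Q) → 𝟙 P? ≡ 𝟙 Q?
𝟙-cong _   _   (yes _) (yes _) = refl
𝟙-cong P⇒Q _   (yes p) (no ¬q) = ⊥-elim (¬q (P⇒Q p))
𝟙-cong _   Q⇒P (no ¬p) (yes q) = ⊥-elim (¬p (Q⇒P q))
𝟙-cong _   _   (no _)  (no _)  = refl

𝟙-no : {P : Set} → ¬ P → (P? : Dec P) → 𝟙 P? ≡ 0
𝟙-no ¬p (yes p) = ⊥-elim (¬p p)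
𝟙-no ¬p (no _)  = refl

length-filter-tabulate : {A : Set} {P : Pred A 0ℓ} (P? : Decidable P) (f : Fin m → A) →
                         length (filter P? (List.tabulate f)) ≡ ∑[ i < m ] 𝟙 (P? (f i))
length-filter-tabulate {zero}  P? f = refl
length-filter-tabulate {suc m} P? f with P? (f zero)
... | yes _ = cong suc (length-filter-tabulate P? (f ∘ suc))
... | no _  = length-filter-tabulate P? (f ∘ suc)

∑-const : ∀ m c → ∑[ i < m ] c ≡ m * c
∑-const zero    c = refl
∑-const (suc m) c = cong (c +_) (∑-const m c)

∑-remove-suc : (x : Fin (suc m)) (s t : ℕ → ℕ) →
               (∀ q → q ≤ toℕ x → s q ≡ t q) → (∀ q → toℕ x < q → s (suc q) ≡ t q) →
               ∑[ q < suc (suc m) ] s (toℕ q) ≡ s (suc (toℕ x)) + ∑[ q < suc m ] t (toℕ q)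
∑-remove-suc x s t below above =
  trans (sum-remove {i = suc x} (s ∘ toℕ)) (cong (s (suc (toℕ x)) +_) (sum-cong-≗ shift))
  where
  shift : ∀ q → s (toℕ (punchIn (suc x) q)) ≡ t (toℕ q)
  shift q with toℕ q ≤? toℕ x
  ... | yes q≤x = trans (cong s (toℕ-punchIn-< (suc x) q (s≤s q≤x))) (below _ q≤x)
  ... | no q≰x  = trans (cong s (toℕ-punchIn-≥ (suc x) q (≰⇒> q≰x))) (above _ (≰⇒> q≰x))

sum-map-tabulate : {A : Set} (φ : A → ℕ) (f : Fin m → A) → sum (map φ (List.tabulate f)) ≡ ∑[ i < m ] φ (f i)
sum-map-tabulate {zero}  φ f = refl
sum-map-tabulate {suc m} φ f = cong (φ (f zero) +_) (sum-map-tabulate φ (f ∘ suc))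

length-concatMap-const : {A B : Set} {f : A → List B} {xs : List A} (c : ℕ) →
                         All (λ x → length (f x) ≡ c) xs → length (concatMap f xs) ≡ c * length xs
length-concatMap-const c [] = sym (*-zeroʳ c)
length-concatMap-const {f = f} {x ∷ xs} c (len-fx ∷ lens) =
  trans (length-++ (f x)) (trans (cong₂ _+_ len-fx (length-concatMap-const c lens)) (sym (*-suc c (length xs))))

sum-concatMap-affine : {A B : Set} {f : A → List B} {xs : List A} (φ : B → ℕ) (ψ : A → ℕ) (b : ℕ) →
                       All (λ x → sum (map φ (f x)) ≡ b * ψ x + 1) xs →
                       sum (map φ (concatMap f xs)) ≡ b * sum (map ψ xs) + length xs
sum-concatMap-affine φ ψ b [] = cong (_+ 0) (sym (*-zeroʳ b))
sum-concatMap-affine {f = f} {x ∷ xs} φ ψ b (sum-fx ∷ sums) = begin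
  sum (map φ (f x ++ concatMap f xs))                          ≡⟨ cong sum (map-++ φ (f x) (concatMap f xs)) ⟩
  sum (map φ (f x) ++ map φ (concatMap f xs))                  ≡⟨ sum-++ (map φ (f x)) _ ⟩
  sum (map φ (f x)) + sum (map φ (concatMap f xs))             ≡⟨ cong₂ _+_ sum-fx (sum-concatMap-affine φ ψ b sums) ⟩
  (b * ψ x + 1) + (b * sum (map ψ xs) + length xs)             ≡⟨ regroup b (ψ x) (sum (map ψ xs)) (length xs) ⟩
  b * (ψ x + sum (map ψ xs)) + suc (length xs)                 ∎
  where
  open ≡-Reasoning
  regroup : ∀ b y s l → (b * y + 1) + (b * s + l) ≡ b * (y + s) + suc l
  regroup = solve-∀

concatMap-unique : {A B : Set} {f : A → List B} {xs : List A} → Unique xs → (∀ x → Unique (f x)) →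
                   (∀ {x y z} → z ∈ f x → z ∈ f y → x ≡ y) → Unique (concatMap f xs)
concatMap-unique {xs = []}     []            _        _         = []
concatMap-unique {f = f} {x ∷ xs} (x∉xs ∷ uniq) f-unique f-disjoint =
  Unique.++⁺ (f-unique x) (concatMap-unique uniq f-unique f-disjoint) λ (z∈fx , z∈rest) →
    let y , y∈xs , z∈fy = find (∈-concatMap⁻ f {xs = xs} z∈rest) in All.lookup x∉xs y∈xs (f-disjoint z∈fx z∈fy)

≗-lookup⇒≡ : {A : Set} {u v : Vec A m} → (∀ j → lookup u j ≡ lookup v j) → u ≡ v
≗-lookup⇒≡ {u = u} {v} eq = trans (sym (Vec.tabulate∘lookup u)) (trans (Vec.tabulate-cong eq) (Vec.tabulate∘lookup v))

lookup-removeAt-punchIn : {A : Set} (w : Vec A (suc m)) (j : Fin (suc m)) (e : Fin m) →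
                          lookup (Vec.removeAt w j) e ≡ lookup w (punchIn j e)
lookup-removeAt-punchIn w j e =
  subst (λ x → lookup (Vec.removeAt w j) x ≡ lookup w (punchIn j e))
        (Fin.punchOut-punchIn j) (Vec.removeAt-punchOut w (Fin.punchInᵢ≢i j e ∘ sym))

First : Pred (Fin m) 0ℓ → Fin m → Set
First P i = P i × (∀ j → toℕ j < toℕ i → ¬ P j)

first : {P : Pred (Fin m) 0ℓ} → Decidable P → ∃ P → ∃ (First P)
first {suc m} P? (i , pᵢ) with P? zero
... | yes p₀ = zero , p₀ , λ _ ()
first {suc m} P? (zero , p₀)  | no ¬p₀ = ⊥-elim (¬p₀ p₀)
first {suc m} P? (suc i , pᵢ) | no ¬p₀ with first (P? ∘ suc) (i , pᵢ)
... | j , pⱼ , least = suc j , pⱼ , λ { zero _ → ¬p₀ ; (suc j′) (s≤s j′<j) → least j′ j′<j }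

first? : {P : Pred (Fin m) 0ℓ} → Decidable P → Dec (∃ (First P))
first? P? = map′ (first P?) (λ (i , pᵢ , _) → i , pᵢ) (any? P?)

First-unique : {P : Pred (Fin m) 0ℓ} {i j : Fin m} → First P i → First P j → i ≡ j
First-unique {i = i} {j} (pᵢ , leastᵢ) (pⱼ , leastⱼ) with Fin.<-cmp i j
... | tri< i<j _ _ = ⊥-elim (leastⱼ i i<j pᵢ)
... | tri≈ _ i≡j _ = i≡j
... | tri> _ _ j<i = ⊥-elim (leastᵢ j j<i pⱼ)

module _ {n k : ℕ} (v : Vec (Fin k) n) where

  -- Gap q lies between positions q - 1 and q; it is covered if a block has elements on both sides.
  Covered : ℕ → Set
  Covered q = ∃₂ λ e₁ e₂ → lookup v e₁ ≡ lookup v e₂ × toℕ e₁ < q × q ≤ toℕ e₂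

  uncovered? : ∀ q → Dec (¬ Covered q)
  uncovered? q = ¬? (any? λ e₁ → any? λ e₂ →
    (lookup v e₁ Fin.≟ lookup v e₂) ×-dec (toℕ e₁ <? q) ×-dec (q ≤? toℕ e₂))

  uncoveredGaps : ℕ
  uncoveredGaps = ∑[ q < suc n ] 𝟙 (uncovered? (toℕ q))

  nested-irrefl : ∀ a → ¬ Nested v a a
  nested-irrefl a ((w , wₐ , w<) , _) = <-irrefl refl (w< w wₐ)

  outCount≡∑ : outCount v ≡ ∑[ a < k ] 𝟙 (outer? v a)
  outCount≡∑ = length-filter-tabulate (outer? v) (λ a → a)

𝟙-uncovered-cong : ∀ {n n′ k k′} (v : Vec (Fin k) n) (v′ : Vec (Fin k′) n′) q q′ →
                   (Covered v q → Covered v′ q′) → (Covered v′ q′ → Covered v q) →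
                   𝟙 (uncovered? v q) ≡ 𝟙 (uncovered? v′ q′)
𝟙-uncovered-cong v v′ q q′ to from =
  𝟙-cong (λ ¬c c′ → ¬c (from c′)) (λ ¬c′ c → ¬c′ (to c)) (uncovered? v q) (uncovered? v′ q′)

Code-≡ : ∀ {n k k′} {x : Vec (Fin k) n} {y : Vec (Fin k′) n} →
         _≡_ {A = Code n} (k , x) (k′ , y) → Σ (k ≡ k′) λ { refl → x ≡ y }
Code-≡ refl = refl , refl

-- A position between two top-labelled ones with another label would, by non-crossing, lie in a
-- block nested inside the top block, and monotonicity would force that block's label above the top.
top-block-convex : ∀ {n k} (w : Vec (Fin (suc k)) n) → NonCrossing w → Monotonic w → ∀ a t b →
                   toℕ a < toℕ t → toℕ t < toℕ b → lookup w a ≡ fromℕ k → lookup w b ≡ fromℕ k →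
                   lookup w t ≡ fromℕ k
top-block-convex {k = k} w nc mono a t b a<t t<b w-a w-b with lookup w t Fin.≟ fromℕ k
... | yes w-t = w-t
... | no w-t≢top = ⊥-elim (<⇒≱ (mono (lookup w t) (fromℕ k) t-inside-top) (Fin.≤fromℕ (lookup w t)))
  where
  w-a≡w-b : lookup w a ≡ lookup w b
  w-a≡w-b = trans w-a (sym w-b)
  after-a : ∀ x → lookup w x ≡ lookup w t → toℕ a < toℕ x
  after-a x w-x with Fin.<-cmp x a
  ... | tri< x<a _ _ = ⊥-elim (w-t≢top (trans (sym w-x) (trans (nc x a t b x<a a<t t<b w-x w-a≡w-b) w-a)))
  ... | tri≈ _ refl _ = ⊥-elim (w-t≢top (trans (sym w-x) w-a))
  ... | tri> _ _ a<x = a<x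
  before-b : ∀ x → lookup w x ≡ lookup w t → toℕ x < toℕ b
  before-b x w-x with Fin.<-cmp x b
  ... | tri< x<b _ _ = x<b
  ... | tri≈ _ refl _ = ⊥-elim (w-t≢top (trans (sym w-x) w-b))
  ... | tri> _ _ b<x = ⊥-elim (w-t≢top (sym (trans (sym w-a) (nc a t b x a<t t<b b<x w-a≡w-b (sym w-x)))))
  t-inside-top : Nested w (lookup w t) (fromℕ k)
  t-inside-top = (a , w-a , after-a) , (b , w-b , before-b)

-- Inserting a singleton block with the largest label

module InsertTop {m k : ℕ} (p : Fin (suc m)) (v : Vec (Fin k) m) (w : Vec (Fin (suc k)) (suc m))
                 (w-p : lookup w p ≡ fromℕ k)
                 (w-punchIn : ∀ e → lookup w (punchIn p e) ≡ inject₁ (lookup v e)) where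

  private
    old≢top : ∀ e → lookup w (punchIn p e) ≢ fromℕ k
    old≢top e eq = Fin.fromℕ≢inject₁ (trans (sym eq) (w-punchIn e))

    w-at-punchIn : ∀ {e a} → lookup v e ≡ a → lookup w (punchIn p e) ≡ inject₁ a
    w-at-punchIn {e} vₑ = trans (w-punchIn e) (cong inject₁ vₑ)

  top-only-at-p : ∀ x → lookup w x ≡ fromℕ k → x ≡ p
  top-only-at-p x wₓ with punchInView p x
  ... | pivot     = refl
  ... | punched e = ⊥-elim (old≢top e wₓ)

  old-position : ∀ x a → lookup w x ≡ inject₁ a → ∃ λ e → punchIn p e ≡ x × lookup v e ≡ a
  old-position x a wₓ with punchInView p x
  ... | pivot     = ⊥-elim (Fin.fromℕ≢inject₁ (trans (sym w-p) wₓ))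
  ... | punched e = e , refl , Fin.inject₁-injective (trans (sym (w-punchIn e)) wₓ)

  same-block⁻ : ∀ x y → toℕ x < toℕ y → lookup w x ≡ lookup w y →
                   ∃₂ λ e₁ e₂ → punchIn p e₁ ≡ x × punchIn p e₂ ≡ y × lookup v e₁ ≡ lookup v e₂
  same-block⁻ x y x<y wₓ≡wᵧ with punchInView p x | punchInView p y
  ... | pivot      | pivot      = ⊥-elim (<-irrefl refl x<y)
  ... | pivot      | punched e  = ⊥-elim (old≢top e (trans (sym wₓ≡wᵧ) w-p))
  ... | punched e  | pivot      = ⊥-elim (old≢top e (trans wₓ≡wᵧ w-p))
  ... | punched e₁ | punched e₂ =
    e₁ , e₂ , refl , refl , Fin.inject₁-injective (trans (sym (w-punchIn e₁)) (trans wₓ≡wᵧ (w-punchIn e₂)))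

  same-block⁺ : ∀ e₁ e₂ → lookup v e₁ ≡ lookup v e₂ → lookup w (punchIn p e₁) ≡ lookup w (punchIn p e₂)
  same-block⁺ e₁ e₂ eq = trans (w-at-punchIn eq) (sym (w-punchIn e₂))

  nonCrossing⁺ : NonCrossing v → NonCrossing w
  nonCrossing⁺ nc i j l m′ i<j j<l l<m′ wᵢ≡wₗ wⱼ≡wₘ
    with same-block⁻ i l (<-trans i<j j<l) wᵢ≡wₗ | same-block⁻ j m′ (<-trans j<l l<m′) wⱼ≡wₘ
  ... | e₁ , e₃ , refl , refl , v₁≡v₃ | e₂ , e₄ , refl , refl , v₂≡v₄ =
    same-block⁺ e₁ e₂ (nc e₁ e₂ e₃ e₄ (punchIn-cancel-< p e₁ e₂ i<j) (punchIn-cancel-< p e₂ e₃ j<l)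
                          (punchIn-cancel-< p e₃ e₄ l<m′) v₁≡v₃ v₂≡v₄)

  nonCrossing⁻ : NonCrossing w → NonCrossing v
  nonCrossing⁻ nc e₁ e₂ e₃ e₄ e₁<e₂ e₂<e₃ e₃<e₄ v₁≡v₃ v₂≡v₄ =
    Fin.inject₁-injective (trans (sym (w-punchIn e₁)) (trans
      (nc (punchIn p e₁) (punchIn p e₂) (punchIn p e₃) (punchIn p e₄)
          (punchIn-mono-< p e₁ e₂ e₁<e₂) (punchIn-mono-< p e₂ e₃ e₂<e₃) (punchIn-mono-< p e₃ e₄ e₃<e₄)
          (same-block⁺ e₁ e₃ v₁≡v₃) (same-block⁺ e₂ e₄ v₂≡v₄))
      (w-punchIn e₂)))

  nested⁺ : ∀ a b → Nested v a b → Nested w (inject₁ a) (inject₁ b)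
  nested⁺ a b ((l , vₗ , l<) , (r , vᵣ , <r)) =
    (punchIn p l , w-at-punchIn vₗ , left) , (punchIn p r , w-at-punchIn vᵣ , right)
    where
    left : ∀ x → lookup w x ≡ inject₁ a → toℕ (punchIn p l) < toℕ x
    left x wₓ with old-position x a wₓ
    ... | e , refl , vₑ = punchIn-mono-< p l e (l< e vₑ)
    right : ∀ x → lookup w x ≡ inject₁ a → toℕ x < toℕ (punchIn p r)
    right x wₓ with old-position x a wₓ
    ... | e , refl , vₑ = punchIn-mono-< p e r (<r e vₑ)

  nested⁻ : ∀ a b → Nested w (inject₁ a) (inject₁ b) → Nested v a b
  nested⁻ a b ((l , wₗ , l<) , (r , wᵣ , <r)) with old-position l b wₗ | old-position r b wᵣ
  ... | eₗ , refl , vₗ | eᵣ , refl , vᵣ =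
    (eₗ , vₗ , λ e vₑ → punchIn-cancel-< p eₗ e (l< (punchIn p e) (w-at-punchIn vₑ))) ,
    (eᵣ , vᵣ , λ e vₑ → punchIn-cancel-< p e eᵣ (<r (punchIn p e) (w-at-punchIn vₑ)))

  ¬nested-in-top : Surjective v → ∀ a → ¬ Nested w (inject₁ a) (fromℕ k)
  ¬nested-in-top surj a ((l , wₗ , l<) , (r , wᵣ , <r))
    with top-only-at-p l wₗ | top-only-at-p r wᵣ | surj a
  ... | refl | refl | e , vₑ = <-asym (l< (punchIn p e) (w-at-punchIn vₑ)) (<r (punchIn p e) (w-at-punchIn vₑ))

  surjective⁺ : Surjective v → Surjective w
  surjective⁺ surj a with labelView a
  ... | top   = p , w-p
  ... | old b with surj b
  ... | e , vₑ = punchIn p e , w-at-punchIn vₑ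

  surjective⁻ : Surjective w → Surjective v
  surjective⁻ surj a with surj (inject₁ a)
  ... | x , wₓ with old-position x a wₓ
  ... | e , _ , vₑ = e , vₑ

  monotonic⁺ : Surjective v → Monotonic v → Monotonic w
  monotonic⁺ surj mono a b nst with labelView a | labelView b
  ... | top   | top   = ⊥-elim (nested-irrefl w _ nst)
  ... | top   | old b = Fin.≤∧≢⇒< (Fin.≤fromℕ (inject₁ b)) (Fin.fromℕ≢inject₁ ∘ sym)
  ... | old a | top   = ⊥-elim (¬nested-in-top surj a nst)
  ... | old a | old b rewrite Fin.toℕ-inject₁ a | Fin.toℕ-inject₁ b = mono a b (nested⁻ a b nst)

  monotonic⁻ : Monotonic w → Monotonic v
  monotonic⁻ mono a b nst =
    subst₂ _<_ (Fin.toℕ-inject₁ b) (Fin.toℕ-inject₁ a) (mono (inject₁ a) (inject₁ b) (nested⁺ a b nst))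

  isNCmton⇔ : IsNCmton (k , v) ⇔ IsNCmton (suc k , w)
  isNCmton⇔ = mk⇔
    (λ (surj , nc , mono) → surjective⁺ surj , nonCrossing⁺ nc , monotonic⁺ surj mono)
    (λ (surj , nc , mono) → surjective⁻ surj , nonCrossing⁻ nc , monotonic⁻ mono)

  outer⁺ : Surjective v → ∀ a → Outer v a → Outer w (inject₁ a)
  outer⁺ surj a out (b , nst) with labelView b
  ... | top   = ¬nested-in-top surj a nst
  ... | old b = out (b , nested⁻ a b nst)

  outer⁻ : ∀ a → Outer w (inject₁ a) → Outer v a
  outer⁻ a out (b , nst) = out (inject₁ b , nested⁺ a b nst)

  -- The new singleton {p} is nested inside a block exactly when that block straddles p.
  outer-top⇒uncovered : Outer w (fromℕ k) → ¬ Covered v (toℕ p)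
  outer-top⇒uncovered out (e₁ , e₂ , v₁≡v₂ , e₁<p , p≤e₂) =
    out (inject₁ (lookup v e₁) , (punchIn p e₁ , w-punchIn e₁ , left) , (punchIn p e₂ , w-e₂ , right))
    where
    w-e₂ : lookup w (punchIn p e₂) ≡ inject₁ (lookup v e₁)
    w-e₂ = w-at-punchIn (sym v₁≡v₂)
    left : ∀ x → lookup w x ≡ fromℕ k → toℕ (punchIn p e₁) < toℕ x
    left x wₓ rewrite top-only-at-p x wₓ | toℕ-punchIn-< p e₁ e₁<p = e₁<p
    right : ∀ x → lookup w x ≡ fromℕ k → toℕ x < toℕ (punchIn p e₂)
    right x wₓ rewrite top-only-at-p x wₓ | toℕ-punchIn-≥ p e₂ p≤e₂ = s≤s p≤e₂

  uncovered⇒outer-top : ¬ Covered v (toℕ p) → Outer w (fromℕ k)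
  uncovered⇒outer-top unc (b , nst) with labelView b
  ... | top = nested-irrefl w _ nst
  ... | old b with nst
  ... | (l , wₗ , l<) , (r , wᵣ , <r) with old-position l b wₗ | old-position r b wᵣ
  ... | eₗ , refl , vₗ | eᵣ , refl , vᵣ =
    unc (eₗ , eᵣ , trans vₗ (sym vᵣ) , ≤-<-trans (toℕ≤toℕ-punchIn p eₗ) (l< p w-p) ,
         ≤-pred (<-≤-trans (<r p w-p) (toℕ-punchIn≤suc p eᵣ)))

  covered-below⁻ : ∀ q → q ≤ toℕ p → Covered w q → Covered v q
  covered-below⁻ q q≤p (x₁ , x₂ , wₓ , x₁<q , q≤x₂) with same-block⁻ x₁ x₂ (<-≤-trans x₁<q q≤x₂) wₓ
  ... | e₁ , e₂ , refl , refl , vₑ = e₁ , e₂ , vₑ , ≤-<-trans (toℕ≤toℕ-punchIn p e₁) x₁<q , q≤e₂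
    where
    q≤e₂ : q ≤ toℕ e₂
    q≤e₂ with toℕ e₂ <? toℕ p
    ... | yes e₂<p = subst (q ≤_) (toℕ-punchIn-< p e₂ e₂<p) q≤x₂
    ... | no e₂≮p  = ≤-trans q≤p (≮⇒≥ e₂≮p)

  covered-below⁺ : ∀ q → q ≤ toℕ p → Covered v q → Covered w q
  covered-below⁺ q q≤p (e₁ , e₂ , vₑ , e₁<q , q≤e₂) =
    punchIn p e₁ , punchIn p e₂ , same-block⁺ e₁ e₂ vₑ ,
    subst (_< q) (sym (toℕ-punchIn-< p e₁ (<-≤-trans e₁<q q≤p))) e₁<q ,
    ≤-trans q≤e₂ (toℕ≤toℕ-punchIn p e₂)

  covered-above⁻ : ∀ q → toℕ p ≤ q → Covered w (suc q) → Covered v q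
  covered-above⁻ q p≤q (x₁ , x₂ , wₓ , x₁<q , q<x₂) with same-block⁻ x₁ x₂ (<-≤-trans x₁<q q<x₂) wₓ
  ... | e₁ , e₂ , refl , refl , vₑ = e₁ , e₂ , vₑ , e₁<q , ≤-pred (≤-trans q<x₂ (toℕ-punchIn≤suc p e₂))
    where
    e₁<q : toℕ e₁ < q
    e₁<q with toℕ e₁ <? toℕ p
    ... | yes e₁<p = <-≤-trans e₁<p p≤q
    ... | no e₁≮p  = ≤-pred (subst (_< suc q) (toℕ-punchIn-≥ p e₁ (≮⇒≥ e₁≮p)) x₁<q)

  covered-above⁺ : ∀ q → toℕ p ≤ q → Covered v q → Covered w (suc q)
  covered-above⁺ q p≤q (e₁ , e₂ , vₑ , e₁<q , q≤e₂) =
    punchIn p e₁ , punchIn p e₂ , same-block⁺ e₁ e₂ vₑ ,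
    ≤-<-trans (toℕ-punchIn≤suc p e₁) (s≤s e₁<q) ,
    subst (suc q ≤_) (sym (toℕ-punchIn-≥ p e₂ (≤-trans p≤q q≤e₂))) (s≤s q≤e₂)

  outCount-insertTop : Surjective v → outCount w ≡ outCount v + 𝟙 (uncovered? v (toℕ p))
  outCount-insertTop surj = begin
    outCount w                                                     ≡⟨ outCount≡∑ w ⟩
    ∑[ a < suc k ] 𝟙 (outer? w a)                                  ≡⟨ sum-init-last (𝟙 ∘ outer? w) ⟩
    ∑[ a < k ] 𝟙 (outer? w (inject₁ a)) + 𝟙 (outer? w (fromℕ k))  ≡⟨ cong₂ _+_ (sum-cong-≗ old-blocks) new-block ⟩
    ∑[ a < k ] 𝟙 (outer? v a) + X                                  ≡⟨ cong (_+ X) (outCount≡∑ v) ⟨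
    outCount v + X                                                 ∎
    where
    open ≡-Reasoning
    X = 𝟙 (uncovered? v (toℕ p))
    old-blocks : ∀ a → 𝟙 (outer? w (inject₁ a)) ≡ 𝟙 (outer? v a)
    old-blocks a = 𝟙-cong (outer⁻ a) (outer⁺ surj a) (outer? w (inject₁ a)) (outer? v a)
    new-block : 𝟙 (outer? w (fromℕ k)) ≡ 𝟙 (uncovered? v (toℕ p))
    new-block = 𝟙-cong outer-top⇒uncovered uncovered⇒outer-top (outer? w (fromℕ k)) (uncovered? v (toℕ p))

  -- Inserting {p} splits gap p of v into the gaps p and p + 1 of w.
  uncoveredGaps-insertTop : uncoveredGaps w ≡ 𝟙 (uncovered? v (toℕ p)) + uncoveredGaps v
  uncoveredGaps-insertTop =
    trans (∑-remove-suc p (𝟙 ∘ uncovered? w) (𝟙 ∘ uncovered? v) below (λ q → above q ∘ <⇒≤))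
          (cong (_+ _) (above (toℕ p) ≤-refl))
    where
    below : ∀ q → q ≤ toℕ p → 𝟙 (uncovered? w q) ≡ 𝟙 (uncovered? v q)
    below q q≤p = 𝟙-uncovered-cong w v q q (covered-below⁻ q q≤p) (covered-below⁺ q q≤p)
    above : ∀ q → toℕ p ≤ q → 𝟙 (uncovered? w (suc q)) ≡ 𝟙 (uncovered? v q)
    above q p≤q = 𝟙-uncovered-cong w v (suc q) q (covered-above⁻ q p≤q) (covered-above⁺ q p≤q)

insertTop : Vec (Fin k) m → Fin (suc m) → Vec (Fin (suc k)) (suc m)
insertTop {k} v p = Vec.insertAt (Vec.map inject₁ v) p (fromℕ k)

lookup-insertTop-pivot : (v : Vec (Fin k) m) (p : Fin (suc m)) → lookup (insertTop v p) p ≡ fromℕ k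
lookup-insertTop-pivot v p = Vec.insertAt-lookup (Vec.map inject₁ v) p _

lookup-insertTop-punchIn : (v : Vec (Fin k) m) (p : Fin (suc m)) (e : Fin m) →
                           lookup (insertTop v p) (punchIn p e) ≡ inject₁ (lookup v e)
lookup-insertTop-punchIn v p e = trans (Vec.insertAt-punchIn (Vec.map inject₁ v) p _ e) (Vec.lookup-map e inject₁ v)

module InsertTopOf {m k : ℕ} (v : Vec (Fin k) m) (p : Fin (suc m)) =
  InsertTop p v (insertTop v p) (lookup-insertTop-pivot v p) (lookup-insertTop-punchIn v p)

insertTop-parent : (w : Vec (Fin (suc k)) (suc m)) (p : Fin (suc m)) → lookup w p ≡ fromℕ k →
                   (∀ j → j ≢ p → lookup w j ≢ fromℕ k) → ∃ λ v → insertTop v p ≡ w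
insertTop-parent {k} w p w-p only-p = v , ≗-lookup⇒≡ agree
  where
  k≢ : ∀ e → k ≢ toℕ (lookup w (punchIn p e))
  k≢ e eq = only-p (punchIn p e) (Fin.punchInᵢ≢i p e) (Fin.toℕ-injective (trans (sym eq) (sym (Fin.toℕ-fromℕ k))))
  v = Vec.tabulate λ e → lower₁ (lookup w (punchIn p e)) (k≢ e)
  agree : ∀ j → lookup (insertTop v p) j ≡ lookup w j
  agree j with punchInView p j
  ... | pivot     = trans (lookup-insertTop-pivot v p) (sym w-p)
  ... | punched e = begin
    lookup (insertTop v p) (punchIn p e)         ≡⟨ lookup-insertTop-punchIn v p e ⟩
    inject₁ (lookup v e)                         ≡⟨ cong inject₁ (Vec.lookup∘tabulate _ e) ⟩
    inject₁ (lower₁ (lookup w (punchIn p e)) _)  ≡⟨ Fin.inject₁-lower₁ _ (k≢ e) ⟩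
    lookup w (punchIn p e)                       ∎
    where open ≡-Reasoning

insertTop-injective : {v v′ : Vec (Fin k) m} {p p′ : Fin (suc m)} → insertTop v p ≡ insertTop v′ p′ → v ≡ v′ × p ≡ p′
insertTop-injective {v = v} {v′} {p} {p′} eq
  with InsertTopOf.top-only-at-p v′ p′ p (trans (cong (λ u → lookup u p) (sym eq)) (lookup-insertTop-pivot v p))
... | refl = ≗-lookup⇒≡ (λ e → Fin.inject₁-injective (begin
  inject₁ (lookup v e)                   ≡⟨ lookup-insertTop-punchIn v p e ⟨
  lookup (insertTop v p) (punchIn p e)   ≡⟨ cong (λ u → lookup u (punchIn p e)) eq ⟩
  lookup (insertTop v′ p) (punchIn p e)  ≡⟨ lookup-insertTop-punchIn v′ p e ⟩
  inject₁ (lookup v′ e)                  ∎)) , refl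
  where open ≡-Reasoning

-- Duplicating a position

module Duplicate {m k : ℕ} (i : Fin m) (v : Vec (Fin k) m) (w : Vec (Fin k) (suc m))
                 (w-pinch : ∀ j → lookup w j ≡ lookup v (pinch i j)) where

  private
    w-punchIn : ∀ e → lookup w (punchIn (suc i) e) ≡ lookup v e
    w-punchIn e = trans (w-pinch (punchIn (suc i) e)) (cong (lookup v) (pinch-punchIn-suc i e))

    v-at-pinch : ∀ {x c} → lookup w x ≡ c → lookup v (pinch i x) ≡ c
    v-at-pinch {x} wₓ = trans (sym (w-pinch x)) wₓ

    w-at-punchIn : ∀ {e c} → lookup v e ≡ c → lookup w (punchIn (suc i) e) ≡ c
    w-at-punchIn {e} vₑ = trans (w-punchIn e) vₑ

    same-block⁻ : ∀ x y → lookup w x ≡ lookup w y → lookup v (pinch i x) ≡ lookup v (pinch i y)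
    same-block⁻ x y eq = v-at-pinch (trans eq (w-pinch y))

    same-block⁺ : ∀ e₁ e₂ → lookup v e₁ ≡ lookup v e₂ → lookup w (punchIn (suc i) e₁) ≡ lookup w (punchIn (suc i) e₂)
    same-block⁺ e₁ e₂ eq = w-at-punchIn (trans eq (sym (w-punchIn e₂)))

    same-pinch : ∀ {x y} → pinch i x ≡ pinch i y → lookup w x ≡ lookup w y
    same-pinch {x} {y} eq = trans (w-pinch x) (trans (cong (lookup v) eq) (sym (w-pinch y)))

    pinch-< : ∀ x y → toℕ x < toℕ y → pinch i x ≢ pinch i y → toℕ (pinch i x) < toℕ (pinch i y)
    pinch-< x y x<y ≢ = Fin.≤∧≢⇒< (Fin.pinch-mono-≤ i (<⇒≤ x<y)) ≢

    pinch-≤ : ∀ x e → toℕ x ≤ toℕ (punchIn (suc i) e) → toℕ (pinch i x) ≤ toℕ e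
    pinch-≤ x e x≤ = subst (toℕ (pinch i x) ≤_) (cong toℕ (pinch-punchIn-suc i e)) (Fin.pinch-mono-≤ i x≤)

    ≤-pinch : ∀ e x → toℕ (punchIn (suc i) e) ≤ toℕ x → toℕ e ≤ toℕ (pinch i x)
    ≤-pinch e x ≤x = subst (_≤ toℕ (pinch i x)) (cong toℕ (pinch-punchIn-suc i e)) (Fin.pinch-mono-≤ i ≤x)

  -- A crossing of w either comes from a crossing of v, or two of its points are i and suc i.
  nonCrossing⁺ : NonCrossing v → NonCrossing w
  nonCrossing⁺ nc x₁ x₂ x₃ x₄ x₁<x₂ x₂<x₃ x₃<x₄ w₁≡w₃ w₂≡w₄
    with pinch i x₁ Fin.≟ pinch i x₂ | pinch i x₂ Fin.≟ pinch i x₃ | pinch i x₃ Fin.≟ pinch i x₄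
  ... | yes eq | _      | _      = same-pinch eq
  ... | no _   | yes eq | _      = trans w₁≡w₃ (sym (same-pinch eq))
  ... | no _   | no _   | yes eq = trans w₁≡w₃ (trans (same-pinch eq) (sym w₂≡w₄))
  ... | no ≢₁₂ | no ≢₂₃ | no ≢₃₄ = trans (w-pinch x₁) (trans
    (nc (pinch i x₁) (pinch i x₂) (pinch i x₃) (pinch i x₄)
        (pinch-< x₁ x₂ x₁<x₂ ≢₁₂) (pinch-< x₂ x₃ x₂<x₃ ≢₂₃) (pinch-< x₃ x₄ x₃<x₄ ≢₃₄)
        (same-block⁻ x₁ x₃ w₁≡w₃) (same-block⁻ x₂ x₄ w₂≡w₄))
    (sym (w-pinch x₂)))

  nonCrossing⁻ : NonCrossing w → NonCrossing v
  nonCrossing⁻ nc e₁ e₂ e₃ e₄ e₁<e₂ e₂<e₃ e₃<e₄ v₁≡v₃ v₂≡v₄ = trans (sym (w-punchIn e₁)) (trans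
    (nc (punchIn (suc i) e₁) (punchIn (suc i) e₂) (punchIn (suc i) e₃) (punchIn (suc i) e₄)
        (punchIn-mono-< (suc i) e₁ e₂ e₁<e₂) (punchIn-mono-< (suc i) e₂ e₃ e₂<e₃) (punchIn-mono-< (suc i) e₃ e₄ e₃<e₄)
        (same-block⁺ e₁ e₃ v₁≡v₃) (same-block⁺ e₂ e₄ v₂≡v₄))
    (w-punchIn e₂))

  nested⁺ : ∀ a b → Nested v a b → Nested w a b
  nested⁺ a b ((l , vₗ , l<) , (r , vᵣ , <r)) =
    (punchIn (suc i) l , w-at-punchIn vₗ , λ x wₓ → <pinch⇒punchIn-suc< i l x (l< (pinch i x) (v-at-pinch wₓ))) ,
    (punchIn (suc i) r , w-at-punchIn vᵣ , λ x wₓ → pinch<⇒<punchIn-suc i r x (<r (pinch i x) (v-at-pinch wₓ)))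

  nested⁻ : ∀ a b → Nested w a b → Nested v a b
  nested⁻ a b nst@((l , wₗ , l<) , (r , wᵣ , <r)) with a Fin.≟ b
  ... | yes refl = ⊥-elim (nested-irrefl w a nst)
  ... | no a≢b   =
    (pinch i l , v-at-pinch wₗ , λ e vₑ → Fin.≤∧≢⇒< (pinch-≤ l e (<⇒≤ (l< _ (w-at-punchIn vₑ)))) (apart wₗ vₑ)) ,
    (pinch i r , v-at-pinch wᵣ , λ e vₑ → Fin.≤∧≢⇒< (≤-pinch e r (<⇒≤ (<r _ (w-at-punchIn vₑ)))) (apart wᵣ vₑ ∘ sym))
    where
    apart : ∀ {x e} → lookup w x ≡ b → lookup v e ≡ a → pinch i x ≢ e
    apart wₓ vₑ refl = a≢b (trans (sym vₑ) (v-at-pinch wₓ))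

  surjective⁺ : Surjective v → Surjective w
  surjective⁺ surj a with surj a
  ... | e , vₑ = punchIn (suc i) e , trans (w-punchIn e) vₑ

  surjective⁻ : Surjective w → Surjective v
  surjective⁻ surj a with surj a
  ... | x , wₓ = pinch i x , trans (sym (w-pinch x)) wₓ

  isNCmton⇔ : IsNCmton (k , v) ⇔ IsNCmton (k , w)
  isNCmton⇔ = mk⇔
    (λ (surj , nc , mono) → surjective⁺ surj , nonCrossing⁺ nc , λ a b → mono a b ∘ nested⁻ a b)
    (λ (surj , nc , mono) → surjective⁻ surj , nonCrossing⁻ nc , λ a b → mono a b ∘ nested⁺ a b)

  covered-at-copy : Covered w (suc (toℕ (inject₁ i)))
  covered-at-copy = inject₁ i , suc i ,
    trans (w-pinch (inject₁ i)) (trans (cong (lookup v) (trans (pinch-inject₁-self i) (sym (pinch-suc-self i))))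
                                       (sym (w-pinch (suc i)))) ,
    ≤-refl , s≤s (≤-reflexive (Fin.toℕ-inject₁ i))

  covered-below⁻ : ∀ q → q ≤ toℕ i → Covered w q → Covered v q
  covered-below⁻ q q≤i (x₁ , x₂ , wₓ , x₁<q , q≤x₂) =
    pinch i x₁ , pinch i x₂ , same-block⁻ x₁ x₂ wₓ ,
    subst (_< q) (sym (toℕ-pinch-≤ i x₁ (≤-trans (<⇒≤ x₁<q) q≤i))) x₁<q , q≤pinch
    where
    q≤pinch : q ≤ toℕ (pinch i x₂)
    q≤pinch with toℕ x₂ ≤? toℕ i
    ... | yes x₂≤i = subst (q ≤_) (sym (toℕ-pinch-≤ i x₂ x₂≤i)) q≤x₂
    ... | no x₂≰i  = ≤-trans q≤i (≤-pred (subst (suc (toℕ i) ≤_) (sym (suc-toℕ-pinch-> i x₂ (≰⇒> x₂≰i))) (≰⇒> x₂≰i)))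

  covered-below⁺ : ∀ q → q ≤ toℕ i → Covered v q → Covered w q
  covered-below⁺ q q≤i (e₁ , e₂ , vₑ , e₁<q , q≤e₂) =
    punchIn (suc i) e₁ , punchIn (suc i) e₂ , same-block⁺ e₁ e₂ vₑ ,
    subst (_< q) (sym (toℕ-punchIn-< (suc i) e₁ (s≤s (≤-trans (<⇒≤ e₁<q) q≤i)))) e₁<q ,
    ≤-trans q≤e₂ (toℕ≤toℕ-punchIn (suc i) e₂)

  covered-above⁻ : ∀ q → toℕ i < q → Covered w (suc q) → Covered v q
  covered-above⁻ q i<q (x₁ , x₂ , wₓ , x₁<q , q<x₂) =
    pinch i x₁ , pinch i x₂ , same-block⁻ x₁ x₂ wₓ , pinch<q ,
    ≤-pred (subst (suc q ≤_) (sym (suc-toℕ-pinch-> i x₂ (<-≤-trans (<-≤-trans i<q (n≤1+n q)) q<x₂))) q<x₂)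
    where
    pinch<q : toℕ (pinch i x₁) < q
    pinch<q with toℕ x₁ ≤? toℕ i
    ... | yes x₁≤i = subst (_< q) (sym (toℕ-pinch-≤ i x₁ x₁≤i)) (≤-<-trans x₁≤i i<q)
    ... | no x₁≰i  = ≤-pred (subst (_< suc q) (sym (suc-toℕ-pinch-> i x₁ (≰⇒> x₁≰i))) x₁<q)

  covered-above⁺ : ∀ q → toℕ i < q → Covered v q → Covered w (suc q)
  covered-above⁺ q i<q (e₁ , e₂ , vₑ , e₁<q , q≤e₂) =
    punchIn (suc i) e₁ , punchIn (suc i) e₂ , same-block⁺ e₁ e₂ vₑ ,
    ≤-<-trans (toℕ-punchIn≤suc (suc i) e₁) (s≤s e₁<q) ,
    subst (suc q ≤_) (sym (toℕ-punchIn-≥ (suc i) e₂ (≤-trans i<q q≤e₂))) (s≤s q≤e₂)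

  outCount-duplicate : outCount w ≡ outCount v
  outCount-duplicate = begin
    outCount w                    ≡⟨ outCount≡∑ w ⟩
    ∑[ a < k ] 𝟙 (outer? w a)     ≡⟨ sum-cong-≗ (λ a → 𝟙-cong (outer a) (outer⁻¹ a) (outer? w a) (outer? v a)) ⟩
    ∑[ a < k ] 𝟙 (outer? v a)     ≡⟨ outCount≡∑ v ⟨
    outCount v                    ∎
    where
    open ≡-Reasoning
    outer : ∀ a → Outer w a → Outer v a
    outer a out (b , nst) = out (b , nested⁺ a b nst)
    outer⁻¹ : ∀ a → Outer v a → Outer w a
    outer⁻¹ a out (b , nst) = out (b , nested⁻ a b nst)

  uncoveredGaps-duplicate : uncoveredGaps w ≡ uncoveredGaps v
  uncoveredGaps-duplicate =
    trans (∑-remove-suc (inject₁ i) (𝟙 ∘ uncovered? w) (𝟙 ∘ uncovered? v) below above)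
          (cong (_+ _) (𝟙-no (λ unc → unc covered-at-copy) (uncovered? w (suc (toℕ (inject₁ i))))))
    where
    below : ∀ q → q ≤ toℕ (inject₁ i) → 𝟙 (uncovered? w q) ≡ 𝟙 (uncovered? v q)
    below q q≤i = 𝟙-uncovered-cong w v q q (covered-below⁻ q q≤i′) (covered-below⁺ q q≤i′)
      where q≤i′ = subst (q ≤_) (Fin.toℕ-inject₁ i) q≤i
    above : ∀ q → toℕ (inject₁ i) < q → 𝟙 (uncovered? w (suc q)) ≡ 𝟙 (uncovered? v q)
    above q i<q = 𝟙-uncovered-cong w v (suc q) q (covered-above⁻ q i<q′) (covered-above⁺ q i<q′)
      where i<q′ = subst (_< q) (Fin.toℕ-inject₁ i) i<q

duplicate : {A : Set} → Vec A m → Fin m → Vec A (suc m)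
duplicate v i = Vec.tabulate (lookup v ∘ pinch i)

lookup-duplicate : {A : Set} (v : Vec A m) (i : Fin m) (j : Fin (suc m)) → lookup (duplicate v i) j ≡ lookup v (pinch i j)
lookup-duplicate v i = Vec.lookup∘tabulate (lookup v ∘ pinch i)

module DuplicateOf {m k : ℕ} (v : Vec (Fin k) m) (i : Fin m) = Duplicate i v (duplicate v i) (lookup-duplicate v i)

duplicate-removeAt : {A : Set} (w : Vec A (suc m)) (i : Fin m) → lookup w (inject₁ i) ≡ lookup w (suc i) →
                     duplicate (Vec.removeAt w (suc i)) i ≡ w
duplicate-removeAt w i w-i≡w-suc-i = ≗-lookup⇒≡ agree
  where
  agree : ∀ j → lookup (duplicate (Vec.removeAt w (suc i)) i) j ≡ lookup w j
  agree j with j Fin.≟ suc i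
  ... | yes refl = begin
    lookup (duplicate (Vec.removeAt w (suc i)) i) (suc i) ≡⟨ lookup-duplicate (Vec.removeAt w (suc i)) i (suc i) ⟩
    lookup (Vec.removeAt w (suc i)) (pinch i (suc i))     ≡⟨ cong (lookup (Vec.removeAt w (suc i))) (pinch-suc-self i) ⟩
    lookup (Vec.removeAt w (suc i)) i                     ≡⟨ lookup-removeAt-punchIn w (suc i) i ⟩
    lookup w (punchIn (suc i) i)                          ≡⟨ cong (lookup w) (punchIn-suc-self i) ⟩
    lookup w (inject₁ i)                                  ≡⟨ w-i≡w-suc-i ⟩
    lookup w (suc i)                                      ∎
    where open ≡-Reasoning
  ... | no j≢suc-i = trans (lookup-duplicate (Vec.removeAt w (suc i)) i j)
    (trans (lookup-removeAt-punchIn w (suc i) (pinch i j)) (cong (lookup w) (punchIn-suc-pinch i j j≢suc-i)))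

removeAt-duplicate : {A : Set} (v : Vec A m) (i : Fin m) → Vec.removeAt (duplicate v i) (suc i) ≡ v
removeAt-duplicate v i = ≗-lookup⇒≡ λ e →
  trans (lookup-removeAt-punchIn (duplicate v i) (suc i) e)
        (trans (lookup-duplicate v i (punchIn (suc i) e)) (cong (lookup v) (pinch-punchIn-suc i e)))

-- The generating tree

FirstTop : Vec (Fin (suc k)) m → Fin m → Set
FirstTop {k} v = First (λ j → lookup v j ≡ fromℕ k)

firstTop? : (v : Vec (Fin (suc k)) m) → Dec (∃ (FirstTop v))
firstTop? {k} v = first? (λ j → lookup v j Fin.≟ fromℕ k)

firstTop-duplicate : (v : Vec (Fin (suc k)) m) (i : Fin m) → FirstTop v i → FirstTop (duplicate v i) (inject₁ i)
firstTop-duplicate v i (v-i , before-i) =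
  trans (lookup-duplicate v i (inject₁ i)) (trans (cong (lookup v) (pinch-inject₁-self i)) v-i) ,
  λ j j<i top → before-i (pinch i j) (pinch<i j j<i) (trans (sym (lookup-duplicate v i j)) top)
  where
  pinch<i : ∀ j → toℕ j < toℕ (inject₁ i) → toℕ (pinch i j) < toℕ i
  pinch<i j j<i = let j<i′ = subst (toℕ j <_) (Fin.toℕ-inject₁ i) j<i in
    subst (_< toℕ i) (sym (toℕ-pinch-≤ i j (<⇒≤ j<i′))) j<i′

firstTop-removeAt : (w : Vec (Fin (suc k)) (suc m)) (i : Fin m) → FirstTop w (inject₁ i) →
                    FirstTop (Vec.removeAt w (suc i)) i
firstTop-removeAt w i (w-i , before-i) =
  trans (lookup-removeAt-punchIn w (suc i) i) (trans (cong (lookup w) (punchIn-suc-self i)) w-i) ,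
  λ j j<i top → before-i (punchIn (suc i) j) (punchIn<i j j<i) (trans (sym (lookup-removeAt-punchIn w (suc i) j)) top)
  where
  punchIn<i : ∀ j → toℕ j < toℕ i → toℕ (punchIn (suc i) j) < toℕ (inject₁ i)
  punchIn<i j j<i = subst₂ _<_ (sym (toℕ-punchIn-< (suc i) j (s≤s (<⇒≤ j<i)))) (sym (Fin.toℕ-inject₁ i)) j<i

extensionsOf : (v : Vec (Fin (suc k)) m) → Dec (∃ (FirstTop v)) → List (Code (suc m))
extensionsOf v (yes (i , _)) = (_ , duplicate v i) ∷ []
extensionsOf v (no _)        = []

extensions : Code m → List (Code (suc m))
extensions (zero  , v) = []
extensions (suc k , v) = extensionsOf v (firstTop? v)

children : Code m → List (Code (suc m))
children (k , v) = List.tabulate (λ p → suc k , insertTop v p) ++ extensions (k , v)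

enumerate : ∀ m → List (Code m)
enumerate zero    = (0 , []) ∷ []
enumerate (suc m) = concatMap children (enumerate m)

data IsChild : Code m → Code (suc m) → Set where
  inserted   : (v : Vec (Fin k) m) (p : Fin (suc m)) → IsChild (k , v) (suc k , insertTop v p)
  duplicated : (v : Vec (Fin (suc k)) m) (i : Fin m) → FirstTop v i → IsChild (suc k , v) (suc k , duplicate v i)

extensions-≡ : (v : Vec (Fin (suc k)) m) {i : Fin m} → FirstTop v i →
               extensions (suc k , v) ≡ (suc k , duplicate v i) ∷ []
extensions-≡ v first-i with firstTop? v
... | yes (i′ , first-i′) rewrite First-unique first-i first-i′ = refl
... | no ∄first             = ⊥-elim (∄first (_ , first-i))

∈-extensions⁻ : (c : Code m) {z : Code (suc m)} → z ∈ extensions c → IsChild c z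
∈-extensions⁻ (suc k , v) z∈ with firstTop? v | z∈
... | yes (i , first-i) | here refl = duplicated v i first-i

extensions-unique : (c : Code m) → Unique (extensions c)
extensions-unique (zero  , v) = []
extensions-unique (suc k , v) with firstTop? v
... | yes _ = [] ∷ []
... | no _  = []

extensions-labels : (c : Code m) → All (λ z → proj₁ z ≡ proj₁ c) (extensions c)
extensions-labels (zero  , v) = []
extensions-labels (suc k , v) with firstTop? v
... | yes _ = refl ∷ []
... | no _  = []

∈-children⁺ : {c : Code m} {z : Code (suc m)} → IsChild c z → z ∈ children c
∈-children⁺ (inserted v p)                   = ∈-++⁺ˡ (∈-tabulate⁺ {f = λ p → _ , insertTop v p} p)
∈-children⁺ (duplicated {k = k} v i first-i) =
  ∈-++⁺ʳ (List.tabulate (λ p → suc (suc k) , insertTop v p))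
         (subst ((suc k , duplicate v i) ∈_) (sym (extensions-≡ v first-i)) (here refl))

∈-children⁻ : {c : Code m} {z : Code (suc m)} → z ∈ children c → IsChild c z
∈-children⁻ {c = k , v} z∈ with ∈-++⁻ (List.tabulate (λ p → suc k , insertTop v p)) z∈
... | inj₂ z∈ext = ∈-extensions⁻ (k , v) z∈ext
... | inj₁ z∈ins with ∈-tabulate⁻ {f = λ p → suc k , insertTop v p} z∈ins
... | p , refl = inserted v p

∈-enumerate-suc⁺ : {c : Code m} {z : Code (suc m)} → c ∈ enumerate m → IsChild c z → z ∈ enumerate (suc m)
∈-enumerate-suc⁺ c∈ child = ∈-concatMap⁺ children (lose c∈ (∈-children⁺ child))

∈-enumerate-suc⁻ : {z : Code (suc m)} → z ∈ enumerate (suc m) → ∃ λ c → c ∈ enumerate m × IsChild c z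
∈-enumerate-suc⁻ {m} z∈ with find (∈-concatMap⁻ children {xs = enumerate m} z∈)
... | c , c∈ , z∈c = c , c∈ , ∈-children⁻ z∈c

-- For a non-crossing partition the uncovered gaps are the two ends and one gap between each
-- two consecutive outer blocks; instead of proving this directly, it is carried along the generation.
Valid : Code m → Set
Valid (k , v) = IsNCmton (k , v) × uncoveredGaps v ≡ outCount v + 1

child-valid : {c : Code m} {z : Code (suc m)} → IsChild c z → Valid c → Valid z
child-valid (inserted v p) (isNC@(surj , _) , gaps) = Equivalence.to isNCmton⇔ isNC , (begin
  uncoveredGaps (insertTop v p)  ≡⟨ uncoveredGaps-insertTop ⟩
  X + uncoveredGaps v            ≡⟨ cong (X +_) gaps ⟩
  X + (outCount v + 1)           ≡⟨ +-assoc X (outCount v) 1 ⟨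
  X + outCount v + 1             ≡⟨ cong (_+ 1) (+-comm X (outCount v)) ⟩
  outCount v + X + 1             ≡⟨ cong (_+ 1) (outCount-insertTop surj) ⟨
  outCount (insertTop v p) + 1   ∎)
  where
  open InsertTopOf v p
  open ≡-Reasoning
  X = 𝟙 (uncovered? v (toℕ p))
child-valid (duplicated v i _) (isNC , gaps) =
  Equivalence.to isNCmton⇔ isNC , trans uncoveredGaps-duplicate (trans gaps (cong (_+ 1) (sym outCount-duplicate)))
  where open DuplicateOf v i

enumerate-valid : ∀ m → All Valid (enumerate m)
enumerate-valid zero    = (((λ ()) , (λ ()) , (λ ())) , refl) ∷ []
enumerate-valid (suc m) = All.tabulate λ z∈ →
  let c , c∈ , child = ∈-enumerate-suc⁻ z∈ in child-valid child (All.lookup (enumerate-valid m) c∈)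

top-successor : (w : Vec (Fin (suc k)) (suc m)) → NonCrossing w → Monotonic w → (p j : Fin (suc m)) →
                toℕ p < toℕ j → lookup w p ≡ fromℕ k → lookup w j ≡ fromℕ k →
                ∃ λ i → inject₁ i ≡ p × lookup w (suc i) ≡ fromℕ k
top-successor {k} {m} w nc mono p j p<j w-p w-j = i , Fin.inject₁-lower₁ p m≢p , w-suc-i
  where
  m≢p : m ≢ toℕ p
  m≢p m≡p = <⇒≱ p<j (subst (toℕ j ≤_) m≡p (Fin.toℕ≤pred[n] j))
  i = lower₁ p m≢p
  toℕ-suc-i : toℕ (suc i) ≡ suc (toℕ p)
  toℕ-suc-i = cong suc (Fin.toℕ-lower₁ p m≢p)
  w-suc-i : lookup w (suc i) ≡ fromℕ k
  w-suc-i with toℕ (suc i) ≟ toℕ j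
  ... | yes i+1≡j = trans (cong (lookup w) (Fin.toℕ-injective i+1≡j)) w-j
  ... | no i+1≢j  = top-block-convex w nc mono p (suc i) j (subst (toℕ p <_) (sym toℕ-suc-i) ≤-refl)
                      (≤∧≢⇒< (subst (_≤ toℕ j) (sym toℕ-suc-i) p<j) i+1≢j) w-p w-j

singleton-parent : (w : Vec (Fin (suc k)) (suc m)) → IsNCmton (suc k , w) → (p : Fin (suc m)) →
                   lookup w p ≡ fromℕ k → (∀ j → j ≢ p → lookup w j ≢ fromℕ k) →
                   ∃ λ c → IsNCmton c × IsChild c (suc k , w)
singleton-parent {k} w isNC p w-p only-p with insertTop-parent w p w-p only-p
... | v , refl = (k , v) , Equivalence.from (InsertTopOf.isNCmton⇔ v p) isNC , inserted v p

duplicate-parent : (w : Vec (Fin (suc k)) (suc m)) → IsNCmton (suc k , w) → (i : Fin m) →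
                   FirstTop w (inject₁ i) → lookup w (suc i) ≡ fromℕ k →
                   ∃ λ c → IsNCmton c × IsChild c (suc k , w)
duplicate-parent {k} w isNC i first-i w-suc-i = (suc k , v) ,
  Equivalence.from (DuplicateOf.isNCmton⇔ v i) (subst (λ u → IsNCmton (suc k , u)) (sym dup≡w) isNC) ,
  subst (λ u → IsChild (suc k , v) (suc k , u)) dup≡w (duplicated v i (firstTop-removeAt w i first-i))
  where
  v = Vec.removeAt w (suc i)
  dup≡w = duplicate-removeAt w i (trans (proj₁ first-i) (sym w-suc-i))

parent-exists : (w : Vec (Fin (suc k)) (suc m)) → IsNCmton (suc k , w) → ∃ λ c → IsNCmton c × IsChild c (suc k , w)
parent-exists {k} w isNC@(surj , nc , mono) with first (λ j → lookup w j Fin.≟ fromℕ k) (surj (fromℕ k))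
... | p , first-p@(w-p , before-p) with any? (λ j → ¬? (j Fin.≟ p) ×-dec (lookup w j Fin.≟ fromℕ k))
... | no ∄other = singleton-parent w isNC p w-p (λ j j≢p w-j → ∄other (j , j≢p , w-j))
... | yes (j , j≢p , w-j) with top-successor w nc mono p j p<j w-p w-j
  where
  p<j : toℕ p < toℕ j
  p<j with Fin.<-cmp p j
  ... | tri< p<j _ _  = p<j
  ... | tri≈ _ refl _ = ⊥-elim (j≢p refl)
  ... | tri> _ _ j<p  = ⊥-elim (before-p j j<p w-j)
... | i , refl , w-suc-i = duplicate-parent w isNC i first-p w-suc-i

enumerate-complete : ∀ m (x : Code m) → IsNCmton x → x ∈ enumerate m
enumerate-complete zero    (zero  , [])     _           = here refl
enumerate-complete zero    (suc k , [])     (surj , _)  with () ← proj₁ (surj zero)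
enumerate-complete (suc m) (zero  , i ∷ v)  _           with () ← i
enumerate-complete (suc m) (suc k , w)      isNC        with parent-exists w isNC
... | c , isNC-c , child = ∈-enumerate-suc⁺ (enumerate-complete m c isNC-c) child

duplicate-injective : {v v′ : Vec (Fin (suc k)) m} {i i′ : Fin m} → FirstTop v i → FirstTop v′ i′ →
                      duplicate v i ≡ duplicate v′ i′ → v ≡ v′
duplicate-injective {v = v} {v′} {i} {i′} first-i first-i′ eq
  with Fin.inject₁-injective (First-unique (subst (λ u → FirstTop u (inject₁ i)) eq (firstTop-duplicate v i first-i))
                                           (firstTop-duplicate v′ i′ first-i′))
... | refl = begin
  v                                   ≡⟨ removeAt-duplicate v i ⟨
  Vec.removeAt (duplicate v i) (suc i)   ≡⟨ cong (λ u → Vec.removeAt u (suc i)) eq ⟩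
  Vec.removeAt (duplicate v′ i) (suc i)  ≡⟨ removeAt-duplicate v′ i ⟩
  v′                                  ∎
  where open ≡-Reasoning

-- In insertTop v p only position p carries the top label, in duplicate v′ i both inject₁ i and suc i do.
insertTop≢duplicate : (v : Vec (Fin k) m) (p : Fin (suc m)) (v′ : Vec (Fin (suc k)) m) (i : Fin m) →
                      FirstTop v′ i → insertTop v p ≢ duplicate v′ i
insertTop≢duplicate v p v′ i first-i eq =
  Fin.<⇒≢ i<suc-i (trans (top-only-at-p (inject₁ i) (top-at (pinch-inject₁-self i)))
                        (sym (top-only-at-p (suc i) (top-at (pinch-suc-self i)))))
  where
  open InsertTopOf v p
  top-at : ∀ {j} → pinch i j ≡ i → lookup (insertTop v p) j ≡ fromℕ _
  top-at {j} pinch≡i =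
    trans (cong (λ u → lookup u j) eq) (trans (lookup-duplicate v′ i j) (trans (cong (lookup v′) pinch≡i) (proj₁ first-i)))
  i<suc-i : toℕ (inject₁ i) < suc (toℕ i)
  i<suc-i = s≤s (≤-reflexive (Fin.toℕ-inject₁ i))

parent-unique : {c c′ : Code m} {z z′ : Code (suc m)} → IsChild c z → IsChild c′ z′ → z ≡ z′ → c ≡ c′
parent-unique (inserted v p) (inserted v′ p′) eq with Code-≡ eq
... | refl , ins≡ins = cong (_ ,_) (proj₁ (insertTop-injective ins≡ins))
parent-unique (inserted v p) (duplicated v′ i first-i) eq with Code-≡ eq
... | refl , ins≡dup = ⊥-elim (insertTop≢duplicate v p v′ i first-i ins≡dup)
parent-unique (duplicated v i first-i) (inserted v′ p) eq with Code-≡ eq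
... | refl , dup≡ins = ⊥-elim (insertTop≢duplicate v′ p v i first-i (sym dup≡ins))
parent-unique (duplicated v i first-i) (duplicated v′ i′ first-i′) eq with Code-≡ eq
... | refl , dup≡dup = cong (_ ,_) (duplicate-injective first-i first-i′ dup≡dup)

children-unique : (c : Code m) → Unique (children c)
children-unique (k , v) = Unique.++⁺ (Unique.tabulate⁺ insertions-injective) (extensions-unique (k , v)) disjoint
  where
  insertions-injective : ∀ {p p′} → (suc k , insertTop v p) ≡ (suc k , insertTop v p′) → p ≡ p′
  insertions-injective eq with Code-≡ eq
  ... | refl , ins≡ins = proj₂ (insertTop-injective ins≡ins)
  disjoint : ∀ {z} → z ∈ List.tabulate (λ p → suc k , insertTop v p) × z ∈ extensions (k , v) → ⊥
  disjoint (z∈ins , z∈ext) with ∈-tabulate⁻ {f = λ p → suc k , insertTop v p} z∈ins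
  ... | _ , refl with () ← All.lookup (extensions-labels (k , v)) z∈ext

enumerate-unique : ∀ m → Unique (enumerate m)
enumerate-unique zero    = [] ∷ []
enumerate-unique (suc m) = concatMap-unique (enumerate-unique m) children-unique
  (λ z∈c z∈c′ → parent-unique (∈-children⁻ z∈c) (∈-children⁻ z∈c′) refl)

extensions-of-surjective : (v : Vec (Fin k) (suc m)) → Surjective v →
                           ∃ λ z → extensions (k , v) ≡ z ∷ [] × Out z ≡ outCount v
extensions-of-surjective {zero}  v _ with () ← lookup v zero
extensions-of-surjective {suc k} v surj with first (λ j → lookup v j Fin.≟ fromℕ k) (surj (fromℕ k))
... | i , first-i = (suc k , duplicate v i) , extensions-≡ v first-i , DuplicateOf.outCount-duplicate v i

length-children : (c : Code (suc m)) → Valid c → length (children c) ≡ suc (suc m) + 1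
length-children {m} (k , v) ((surj , _) , _) with extensions-of-surjective v surj
... | z , ext≡ , _ = trans (length-++ (List.tabulate (λ p → suc k , insertTop v p)))
                           (cong₂ _+_ (length-tabulate (λ p → suc k , insertTop v p)) (cong length ext≡))

sum-Out-children : (c : Code (suc m)) → Valid c → sum (map Out (children c)) ≡ (suc m + 3) * Out c + 1
sum-Out-children {m} (k , v) ((surj , _) , gaps) with extensions-of-surjective v surj
... | z , ext≡ , Out-z = begin
  sum (map Out (insertions ++ extensions (k , v)))
    ≡⟨ cong sum (map-++ Out insertions (extensions (k , v))) ⟩
  sum (map Out insertions ++ map Out (extensions (k , v)))
    ≡⟨ sum-++ (map Out insertions) _ ⟩
  sum (map Out insertions) + sum (map Out (extensions (k , v)))
    ≡⟨ cong₂ _+_ (sum-map-tabulate Out (λ p → suc k , insertTop v p)) (cong (sum ∘ map Out) ext≡) ⟩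
  ∑[ p < suc (suc m) ] outCount (insertTop v p) + (Out z + 0)
    ≡⟨ cong₂ _+_ (sum-cong-≗ (λ p → InsertTopOf.outCount-insertTop v p surj)) (cong (_+ 0) Out-z) ⟩
  ∑[ p < suc (suc m) ] (O + 𝟙 (uncovered? v (toℕ p))) + (O + 0)
    ≡⟨ cong (_+ (O + 0)) (∑-distrib-+ {suc (suc m)} (λ _ → O) (λ p → 𝟙 (uncovered? v (toℕ p)))) ⟩
  ∑[ p < suc (suc m) ] O + uncoveredGaps v + (O + 0)
    ≡⟨ cong (λ x → x + uncoveredGaps v + (O + 0)) (∑-const (suc (suc m)) O) ⟩
  suc (suc m) * O + uncoveredGaps v + (O + 0)
    ≡⟨ cong (λ g → suc (suc m) * O + g + (O + 0)) gaps ⟩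
  suc (suc m) * O + (O + 1) + (O + 0)
    ≡⟨ regroup m O ⟩
  (suc m + 3) * O + 1 ∎
  where
  open ≡-Reasoning
  insertions = List.tabulate (λ p → suc k , insertTop v p)
  O = outCount v
  regroup : ∀ m o → suc (suc m) * o + (o + 1) + (o + 0) ≡ (suc m + 3) * o + 1
  regroup = solve-∀

length-enumerate-suc : ∀ m → length (enumerate (suc (suc m))) ≡ (suc (suc m) + 1) * length (enumerate (suc m))
length-enumerate-suc m = length-concatMap-const _ (All.map (λ {c} → length-children c) (enumerate-valid (suc m)))

sum-Out-enumerate-suc : ∀ m → sum (map Out (enumerate (suc (suc m)))) ≡
                              (suc m + 3) * sum (map Out (enumerate (suc m))) + length (enumerate (suc m))
sum-Out-enumerate-suc m =
  sum-concatMap-affine Out Out (suc m + 3) (All.map (λ {c} → sum-Out-children c) (enumerate-valid (suc m)))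

3*sum-Out-enumerate : ∀ m → 3 * sum (map Out (enumerate (suc m))) ≡ (2 * suc m + 1) * length (enumerate (suc m))
3*sum-Out-enumerate zero    = refl
3*sum-Out-enumerate (suc m) = begin
  3 * sum (map Out (enumerate (suc (suc m))))        ≡⟨ cong (3 *_) (sum-Out-enumerate-suc m) ⟩
  3 * ((suc m + 3) * S + A)                          ≡⟨ distribute m S A ⟩
  (suc m + 3) * (3 * S) + 3 * A                      ≡⟨ cong (λ t → (suc m + 3) * t + 3 * A) (3*sum-Out-enumerate m) ⟩
  (suc m + 3) * ((2 * suc m + 1) * A) + 3 * A        ≡⟨ collect m A ⟩
  (2 * suc (suc m) + 1) * ((suc (suc m) + 1) * A)    ≡⟨ cong ((2 * suc (suc m) + 1) *_) (length-enumerate-suc m) ⟨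
  (2 * suc (suc m) + 1) * length (enumerate (suc (suc m))) ∎
  where
  open ≡-Reasoning
  S = sum (map Out (enumerate (suc m)))
  A = length (enumerate (suc m))
  distribute : ∀ m s a → 3 * ((suc m + 3) * s + a) ≡ (suc m + 3) * (3 * s) + 3 * a
  distribute = solve-∀
  collect : ∀ m a → (suc m + 3) * ((2 * suc m + 1) * a) + 3 * a ≡ (2 * suc (suc m) + 1) * ((suc (suc m) + 1) * a)
  collect = solve-∀

↭-enumerate : ∀ m (L : List (Code m)) → Unique L → All IsNCmton L → (∀ x → IsNCmton x → x ∈ L) → L ↭ enumerate m
↭-enumerate m L L-unique L-sound L-complete = ∼bag⇒↭ (unique∧set⇒bag L-unique (enumerate-unique m) (mk⇔
  (λ x∈L → enumerate-complete m _ (All.lookup L-sound x∈L))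
  (λ x∈enum → L-complete _ (proj₁ (All.lookup (enumerate-valid m) x∈enum)))))

corollary6p3 : (n : ℕ) → 1 ≤ n → (L : List (Code n)) → Unique L →
    All IsNCmton L → (∀ x → IsNCmton x → x ∈ L) →
    3 * sum (map Out L) ≡ (2 * n + 1) * length L
corollary6p3 (suc m) _ L L-unique L-sound L-complete = begin
  3 * sum (map Out L)                           ≡⟨ cong (3 *_) (sum-↭ (↭-map⁺ Out L↭enumerate)) ⟩
  3 * sum (map Out (enumerate (suc m)))         ≡⟨ 3*sum-Out-enumerate m ⟩
  (2 * suc m + 1) * length (enumerate (suc m))  ≡⟨ cong ((2 * suc m + 1) *_) (↭-length L↭enumerate) ⟨
  (2 * suc m + 1) * length L                    ∎
  where
  open ≡-Reasoning
  L↭enumerate = ↭-enumerate (suc m) L L-unique L-sound L-complete
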